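{- Let $k\geq 2$. For every $N\in\{0,1,2,\dots\}$, the oriented de Bruijn graph $\vec B_{k,N}$ is weakly isomorphic (i.e. isomorphic as oriented graphs, ignoring labels) to $\vec\Gamma_{k,N}$, the graph of the action of $\mathcal L_k$ on the $N$-th level of the $k$-regular rooted tree with respect to the generating set $X_k=\{\bar c_0,\dots,\bar c_{k-1}\}$.
   Context: An oriented graph has vertices, edges and maps $\iota,\tau$; loops and multiple edges allowed. The oriented de Bruijn graph $\vec B_{k,N}$ has vertex set $\{0,\dots,k-1\}^N$ and, for each vertex $x_1\dots x_N$ and each $y\in\{0,\dots,k-1\}$, one edge labeled $R_y$ from $x_1\dots x_N$ to $x_2\dots x_Ny$. $\mathcal L_k=(\mathbb Z/k\mathbb Z)\wr\mathbb Z$, $b$ the generator of $\mathbb Z$, $c$ the generator of the copy of $\mathbb Z/k\mathbb Z$ at coordinate 0, and $\bar c_r=c^rb$. $\mathcal L_k$ acts on words over $\{0,\dots,k-1\}$ (vertices of the $k$-regular rooted tree) by $\bar c_r.(x_1x_2x_3\dots)=\bigl((x_1+r)(x_2+x_1)(x_3+x_2)\dots\bigr)$, additions mod $k$. $\vec\Gamma_{k,N}$ is the oriented graph with vertex set the words of length $N$ and, for each vertex $v$ and each $r$, an edge labeled $\bar c_r$ from $v$ to $\bar c_r.v$. -}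

module Defs where

open import Data.Nat using (ℕ; zero; suc)
import Data.Nat as ℕ
open import Data.Nat.DivMod using (_mod_)
open import Data.Fin using (Fin; toℕ)
open import Data.Vec using (Vec; []; _∷_; _∷ʳ_)
open import Data.Product using (Σ; _×_; _,_; proj₁; proj₂)
open import Function.Bundles using (_⤖_; Bijection)
open import Relation.Binary.PropositionalEquality using (_≡_)

record OrientedGraph : Set₁ where
  field
    V : Set
    E : Set
    ι : E → V
    τ : E → V

open OrientedGraph public

record WeaklyIsomorphic (G H : OrientedGraph) : Set where
  field
    vertexBij : V G ⤖ V H
    edgeBij   : E G ⤖ E H
    pres-ι : ∀ e → ι H (Bijection.to edgeBij e) ≡ Bijection.to vertexBij (ι G e)
    pres-τ : ∀ e → τ H (Bijection.to edgeBij e) ≡ Bijection.to vertexBij (τ G e)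

_⊕_ : ∀ {k} → Fin k → Fin k → Fin k
_⊕_ {suc n} a b = (toℕ a ℕ.+ toℕ b) mod suc n

-- Words of length N over {0,…,k-1}: level N of the k-regular rooted tree.
Word : ℕ → ℕ → Set
Word k N = Vec (Fin k) N

shiftIn : ∀ {k N} → Word k N → Fin k → Word k N
shiftIn []       y = []
shiftIn (x ∷ xs) y = xs ∷ʳ y

deBruijn : ℕ → ℕ → OrientedGraph
deBruijn k N = record
  { V = Word k N
  ; E = Word k N × Fin k
  ; ι = proj₁
  ; τ = λ { (x , y) → shiftIn x y }
  }

-- Action of c̄_r = c^r b ∈ L_k on words:
-- c̄_r.(x₁x₂x₃…) = (x₁+r)(x₂+x₁)(x₃+x₂)…   (mod k)
cbarAct : ∀ {k N} → Fin k → Word k N → Word k N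
cbarAct r []       = []
cbarAct r (x ∷ xs) = (x ⊕ r) ∷ cbarAct x xs

-- Γ⃗_{k,N}: Schreier graph of L_k on level N w.r.t. X_k = {c̄_0,…,c̄_{k-1}};
-- one edge (labeled c̄_r) from v to c̄_r.v for each vertex v and each r.
gammaGraph : ℕ → ℕ → OrientedGraph
gammaGraph k N = record
  { V = Word k N
  ; E = Word k N × Fin k
  ; ι = proj₁
  ; τ = λ { (v , r) → cbarAct r v }
  }

-- Write a word v as the top row of a triangle whose next row consists of the
-- consecutive sums (mod k) of the previous one, and send v to the right edge
-- of this triangle (the last entries of its rows).  The first row below r v is
-- exactly c̄_r.v, and the triangle of r v contains the triangle of v; hence
-- the right edge of c̄_r.v is the right edge of v shifted by one, followed by
-- the apex of the triangle of r v.  So the edge c̄_r at v is sent to a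
-- de Bruijn edge.  A word is recovered from its last letter and its
-- consecutive sums, so the right-edge map is bijective, and for fixed v the
-- map r ↦ apex (r v) is a composite of translations, hence a bijection of
-- the labels.
module Submission where

open import Defs
open import Data.Nat using (ℕ; zero; suc; _≤_; _<_; _+_; _∸_; _%_; NonZero)
open import Data.Nat.Properties using (+-comm; +-assoc; m+[n∸m]≡n; <⇒≤; +-commutativeSemigroup)
open import Algebra.Properties.CommutativeSemigroup +-commutativeSemigroup using (x∙yz≈y∙xz)
open import Data.Nat.DivMod using (_mod_; %-distribˡ-+; m%n%n≡m%n; [m+n]%n≡m%n; m<n⇒m%n≡m)
open import Data.Fin using (Fin; toℕ)
open import Data.Fin.Properties using (toℕ-fromℕ<; toℕ-injective; toℕ<n; nonZeroIndex)
open import Data.Vec using ([]; _∷_; head; last)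
open import Data.Product using (_,_; proj₂)
open import Data.Product.Function.Dependent.Propositional using (Σ-↔)
open import Function.Bundles using (_⤖_; _↔_; Bijection; mk↔ₛ′; Inverse)
open import Function.Construct.Symmetry using (⤖-sym)
open import Function.Properties.Inverse using (↔-refl; ↔-trans; ↔⇒⤖)
open import Relation.Binary.PropositionalEquality
open ≡-Reasoning

variable
  k n : ℕ

_⊖_ : Fin k → Fin k → Fin k
_⊖_ {suc m} w a = (suc m ∸ toℕ a + toℕ w) mod suc m

[i+j%n]%n≡[i+j]%n : ∀ i j n .{{_ : NonZero n}} → (i + j % n) % n ≡ (i + j) % n
[i+j%n]%n≡[i+j]%n i j n = begin
  (i + j % n) % n          ≡⟨ %-distribˡ-+ i (j % n) n ⟩
  (i % n + j % n % n) % n  ≡⟨ cong (λ z → (i % n + z) % n) (m%n%n≡m%n j n) ⟩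
  (i % n + j % n) % n      ≡⟨ %-distribˡ-+ i j n ⟨
  (i + j) % n              ∎

toℕ-⊕ : (a b : Fin k) .{{_ : NonZero k}} → toℕ (a ⊕ b) ≡ (toℕ a + toℕ b) % k
toℕ-⊕ {suc _} a b = toℕ-fromℕ< _

toℕ-⊖ : (w a : Fin k) .{{_ : NonZero k}} → toℕ (w ⊖ a) ≡ (k ∸ toℕ a + toℕ w) % k
toℕ-⊖ {suc _} w a = toℕ-fromℕ< _

[a+[n∸a+w]]%n≡w : ∀ {a w n} .{{_ : NonZero n}} → a ≤ n → w < n → (a + (n ∸ a + w)) % n ≡ w
[a+[n∸a+w]]%n≡w {a} {w} {n} a≤n w<n = begin
  (a + (n ∸ a + w)) % n  ≡⟨ cong (_% n) (+-assoc a (n ∸ a) w) ⟨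
  (a + (n ∸ a) + w) % n  ≡⟨ cong (λ z → (z + w) % n) (m+[n∸m]≡n a≤n) ⟩
  (n + w) % n            ≡⟨ cong (_% n) (+-comm n w) ⟩
  (w + n) % n            ≡⟨ [m+n]%n≡m%n w n ⟩
  w % n                  ≡⟨ m<n⇒m%n≡m w<n ⟩
  w                      ∎

a⊕[w⊖a]≡w : (a w : Fin k) → a ⊕ (w ⊖ a) ≡ w
a⊕[w⊖a]≡w {k} a w = toℕ-injective (begin
  toℕ (a ⊕ (w ⊖ a))                        ≡⟨ toℕ-⊕ a (w ⊖ a) ⟩
  (toℕ a + toℕ (w ⊖ a)) % k                ≡⟨ cong (λ z → (toℕ a + z) % k) (toℕ-⊖ w a) ⟩
  (toℕ a + (k ∸ toℕ a + toℕ w) % k) % k    ≡⟨ [i+j%n]%n≡[i+j]%n (toℕ a) _ k ⟩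
  (toℕ a + (k ∸ toℕ a + toℕ w)) % k        ≡⟨ [a+[n∸a+w]]%n≡w (<⇒≤ (toℕ<n a)) (toℕ<n w) ⟩
  toℕ w                                    ∎)
  where instance _ = nonZeroIndex a

[a⊕b]⊖a≡b : (a b : Fin k) → (a ⊕ b) ⊖ a ≡ b
[a⊕b]⊖a≡b {k} a b = toℕ-injective (begin
  toℕ ((a ⊕ b) ⊖ a)                        ≡⟨ toℕ-⊖ (a ⊕ b) a ⟩
  (k ∸ toℕ a + toℕ (a ⊕ b)) % k            ≡⟨ cong (λ z → (k ∸ toℕ a + z) % k) (toℕ-⊕ a b) ⟩
  (k ∸ toℕ a + (toℕ a + toℕ b) % k) % k    ≡⟨ [i+j%n]%n≡[i+j]%n (k ∸ toℕ a) _ k ⟩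
  (k ∸ toℕ a + (toℕ a + toℕ b)) % k        ≡⟨ cong (_% k) (x∙yz≈y∙xz (k ∸ toℕ a) (toℕ a) (toℕ b)) ⟩
  (toℕ a + (k ∸ toℕ a + toℕ b)) % k        ≡⟨ [a+[n∸a+w]]%n≡w (<⇒≤ (toℕ<n a)) (toℕ<n b) ⟩
  toℕ b                                    ∎)
  where instance _ = nonZeroIndex a

⊕-↔ : Fin k → Fin k ↔ Fin k
⊕-↔ a = mk↔ₛ′ (a ⊕_) (_⊖ a) (a⊕[w⊖a]≡w a) ([a⊕b]⊖a≡b a)

sums : Word k (suc n) → Word k n
sums (x ∷ xs) = cbarAct x xs

sums-∷ : (a : Fin k) (v : Word k (suc n)) → sums (a ∷ v) ≡ (head v ⊕ a) ∷ sums v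
sums-∷ a (x ∷ xs) = refl

last-∷ : (a : Fin k) (v : Word k (suc n)) → last (a ∷ v) ≡ last v
last-∷ a (x ∷ xs) = refl

rightEdge : Word k n → Word k n
rightEdge []       = []
rightEdge (x ∷ xs) = last (x ∷ xs) ∷ rightEdge (sums (x ∷ xs))

rightEdge-∷ : (v : Word k (suc n)) → rightEdge v ≡ last v ∷ rightEdge (sums v)
rightEdge-∷ (x ∷ xs) = refl

apex : Word k (suc n) → Fin k
apex {n = zero}  (x ∷ [])  = x
apex {n = suc _} v         = apex (sums v)

unsums : Fin k → Word k n → Word k (suc n)
unsums l []       = l ∷ []
unsums l (w ∷ ws) = (w ⊖ head p) ∷ p
  where p = unsums l ws

last-unsums : (l : Fin k) (w : Word k n) → last (unsums l w) ≡ l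
last-unsums l []       = refl
last-unsums l (w ∷ ws) = trans (last-∷ (w ⊖ head (unsums l ws)) (unsums l ws)) (last-unsums l ws)

sums-unsums : (l : Fin k) (w : Word k n) → sums (unsums l w) ≡ w
sums-unsums l []       = refl
sums-unsums l (w ∷ ws) = begin
  sums ((w ⊖ head p) ∷ p)           ≡⟨ sums-∷ _ p ⟩
  (head p ⊕ (w ⊖ head p)) ∷ sums p  ≡⟨ cong₂ _∷_ (a⊕[w⊖a]≡w (head p) w) (sums-unsums l ws) ⟩
  w ∷ ws                            ∎
  where p = unsums l ws

unsums-last-sums : (v : Word k (suc n)) → unsums (last v) (sums v) ≡ v
unsums-last-sums (x ∷ [])     = refl
unsums-last-sums (x ∷ y ∷ ys) = begin
  ((y ⊕ x) ⊖ head p) ∷ p          ≡⟨ cong (λ q → ((y ⊕ x) ⊖ head q) ∷ q) (unsums-last-sums (y ∷ ys)) ⟩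
  ((y ⊕ x) ⊖ y) ∷ y ∷ ys          ≡⟨ cong (_∷ y ∷ ys) ([a⊕b]⊖a≡b y x) ⟩
  x ∷ y ∷ ys                      ∎
  where p = unsums (last (y ∷ ys)) (sums (y ∷ ys))

fromRightEdge : Word k n → Word k n
fromRightEdge []       = []
fromRightEdge (u ∷ us) = unsums u (fromRightEdge us)

rightEdge-fromRightEdge : (u : Word k n) → rightEdge (fromRightEdge u) ≡ u
rightEdge-fromRightEdge []       = refl
rightEdge-fromRightEdge (u ∷ us) = begin
  rightEdge v                         ≡⟨ rightEdge-∷ v ⟩
  last v ∷ rightEdge (sums v)         ≡⟨ cong₂ _∷_ (last-unsums u (fromRightEdge us))
                                                     (cong rightEdge (sums-unsums u (fromRightEdge us))) ⟩
  u ∷ rightEdge (fromRightEdge us)    ≡⟨ cong (u ∷_) (rightEdge-fromRightEdge us) ⟩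
  u ∷ us                              ∎
  where v = unsums u (fromRightEdge us)

fromRightEdge-rightEdge : (v : Word k n) → fromRightEdge (rightEdge v) ≡ v
fromRightEdge-rightEdge []       = refl
fromRightEdge-rightEdge v@(_ ∷ _) = begin
  unsums (last v) (fromRightEdge (rightEdge (sums v)))  ≡⟨ cong (unsums (last v)) (fromRightEdge-rightEdge (sums v)) ⟩
  unsums (last v) (sums v)                              ≡⟨ unsums-last-sums v ⟩
  v                                                     ∎

rightEdge-↔ : Word k n ↔ Word k n
rightEdge-↔ = mk↔ₛ′ rightEdge fromRightEdge rightEdge-fromRightEdge fromRightEdge-rightEdge

apex-∷-↔ : Word k n → Fin k ↔ Fin k
apex-∷-↔ []       = ↔-refl
apex-∷-↔ (x ∷ xs) = ↔-trans (⊕-↔ x) (apex-∷-↔ (sums (x ∷ xs)))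

apex-∷-↔-to : (v : Word k n) (r : Fin k) → Inverse.to (apex-∷-↔ v) r ≡ apex (r ∷ v)
apex-∷-↔-to []       r = refl
apex-∷-↔-to (x ∷ xs) r = apex-∷-↔-to (sums (x ∷ xs)) (x ⊕ r)

rightEdge-sums : (r : Fin k) (v : Word k n) → rightEdge (sums (r ∷ v)) ≡ shiftIn (rightEdge v) (apex (r ∷ v))
rightEdge-sums r []           = refl
rightEdge-sums r (x ∷ [])     = refl
rightEdge-sums r (x ∷ y ∷ ys) = cong (last w ∷_) (rightEdge-sums (x ⊕ r) w)
  where w = sums (x ∷ y ∷ ys)

⤖-sym-intertwines : {A B C D : Set} (φ : A ⤖ B) (ψ : C ⤖ D) {f : A → C} {g : B → D} →
  (∀ a → g (Bijection.to φ a) ≡ Bijection.to ψ (f a)) →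
  ∀ b → f (Bijection.to (⤖-sym φ) b) ≡ Bijection.to (⤖-sym ψ) (g b)
⤖-sym-intertwines φ ψ {f} {g} commutes b = ψ.injective (begin
  ψ.to (f (φ.to⁻ b))      ≡⟨ commutes (φ.to⁻ b) ⟨
  g (φ.to (φ.to⁻ b))      ≡⟨ cong g (proj₂ (φ.strictlySurjective b)) ⟩
  g b                     ≡⟨ proj₂ (ψ.strictlySurjective (g b)) ⟨
  ψ.to (ψ.to⁻ (g b))      ∎)
  where
  module φ = Bijection φ
  module ψ = Bijection ψ

WeaklyIsomorphic-sym : {G H : OrientedGraph} → WeaklyIsomorphic G H → WeaklyIsomorphic H G
WeaklyIsomorphic-sym {G} {H} G≅H = record
  { vertexBij = ⤖-sym vertexBij
  ; edgeBij   = ⤖-sym edgeBij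
  ; pres-ι    = ⤖-sym-intertwines edgeBij vertexBij pres-ι
  ; pres-τ    = ⤖-sym-intertwines edgeBij vertexBij pres-τ
  }
  where open WeaklyIsomorphic G≅H

gamma≅deBruijn : (k N : ℕ) → WeaklyIsomorphic (gammaGraph k N) (deBruijn k N)
gamma≅deBruijn k N = record
  { vertexBij = ↔⇒⤖ rightEdge-↔
  ; edgeBij   = ↔⇒⤖ (Σ-↔ rightEdge-↔ λ {v} → apex-∷-↔ v)
  ; pres-ι    = λ _ → refl
  ; pres-τ    = λ (v , r) → begin
      shiftIn (rightEdge v) (Inverse.to (apex-∷-↔ v) r)  ≡⟨ cong (shiftIn (rightEdge v)) (apex-∷-↔-to v r) ⟩
      shiftIn (rightEdge v) (apex (r ∷ v))              ≡⟨ rightEdge-sums r v ⟨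
      rightEdge (cbarAct r v)                           ∎
  }

theorem4p14 : (k : ℕ) → 2 ≤ k → (N : ℕ) →
    WeaklyIsomorphic (deBruijn k N) (gammaGraph k N)
theorem4p14 k _ N = WeaklyIsomorphic-sym (gamma≅deBruijn k N)
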